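{- Let $\mathcal G\subset\mathbb F_2^{24}$ be the extended binary Golay code (with a fixed ordering of its $24$ coordinates). Let $\mathcal O_{10}$ be the set of codewords of $\mathcal G$ of Hamming weight $8$ whose first coordinate is $1$ and whose second coordinate is $0$, and let $\mathcal O_{01}$ be the set of codewords of weight $8$ whose first coordinate is $0$ and whose second coordinate is $1$ (together these are $352$ codewords). Then $\mathcal O_{10}\cup\mathcal O_{01}$ spans $\mathcal G$ as a vector space over $\mathbb F_2$.
   Context: The extended binary Golay code is the $[24,12,8]$ self-dual binary linear code; its codewords of weight $8$ are called octads. -}

module Defs where

open import Data.Bool using (Bool; true; false; _xor_)
open import Data.Nat using (ℕ)
open import Data.Vec using (Vec; []; _∷_; zipWith; replicate; foldr; map; lookup; count)
open import Data.Fin using (Fin; zero; suc)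
open import Data.List as List using (List)
open import Data.List.Relation.Unary.All using (All)
open import Data.Product using (Σ; _×_)
open import Data.Sum using (_⊎_)
open import Relation.Binary.PropositionalEquality using (_≡_)
open import Relation.Nullary.Decidable using (yes; no)
open import Data.Bool.Properties using (T?)

-- Words of F₂²⁴, with F₂ represented by Bool (true = 1) and addition = xor.
Word : Set
Word = Vec Bool 24

_⊕_ : Word → Word → Word
_⊕_ = zipWith _xor_

𝟎 : Word
𝟎 = replicate 24 false

weight : Word → ℕ
weight = count (λ b → T? b)

-- Generator matrix of the extended binary Golay code: the 12 cyclic shifts of
-- g(x) = 1 + x² + x⁴ + x⁵ + x⁶ + x¹⁰ + x¹¹ (generator of the [23,12,7] binary
-- Golay code), each extended by an overall parity bit (coordinate 24).
generator : Vec Word 12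
generator =
      (true  ∷ false ∷ true  ∷ false ∷ true  ∷ true  ∷ true  ∷ false ∷ false ∷ false ∷ true  ∷ true  ∷ false ∷ false ∷ false ∷ false ∷ false ∷ false ∷ false ∷ false ∷ false ∷ false ∷ false ∷ true  ∷ [])
    ∷ (false ∷ true  ∷ false ∷ true  ∷ false ∷ true  ∷ true  ∷ true  ∷ false ∷ false ∷ false ∷ true  ∷ true  ∷ false ∷ false ∷ false ∷ false ∷ false ∷ false ∷ false ∷ false ∷ false ∷ false ∷ true  ∷ [])
    ∷ (false ∷ false ∷ true  ∷ false ∷ true  ∷ false ∷ true  ∷ true  ∷ true  ∷ false ∷ false ∷ false ∷ true  ∷ true  ∷ false ∷ false ∷ false ∷ false ∷ false ∷ false ∷ false ∷ false ∷ false ∷ true  ∷ [])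
    ∷ (false ∷ false ∷ false ∷ true  ∷ false ∷ true  ∷ false ∷ true  ∷ true  ∷ true  ∷ false ∷ false ∷ false ∷ true  ∷ true  ∷ false ∷ false ∷ false ∷ false ∷ false ∷ false ∷ false ∷ false ∷ true  ∷ [])
    ∷ (false ∷ false ∷ false ∷ false ∷ true  ∷ false ∷ true  ∷ false ∷ true  ∷ true  ∷ true  ∷ false ∷ false ∷ false ∷ true  ∷ true  ∷ false ∷ false ∷ false ∷ false ∷ false ∷ false ∷ false ∷ true  ∷ [])
    ∷ (false ∷ false ∷ false ∷ false ∷ false ∷ true  ∷ false ∷ true  ∷ false ∷ true  ∷ true  ∷ true  ∷ false ∷ false ∷ false ∷ true  ∷ true  ∷ false ∷ false ∷ false ∷ false ∷ false ∷ false ∷ true  ∷ [])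
    ∷ (false ∷ false ∷ false ∷ false ∷ false ∷ false ∷ true  ∷ false ∷ true  ∷ false ∷ true  ∷ true  ∷ true  ∷ false ∷ false ∷ false ∷ true  ∷ true  ∷ false ∷ false ∷ false ∷ false ∷ false ∷ true  ∷ [])
    ∷ (false ∷ false ∷ false ∷ false ∷ false ∷ false ∷ false ∷ true  ∷ false ∷ true  ∷ false ∷ true  ∷ true  ∷ true  ∷ false ∷ false ∷ false ∷ true  ∷ true  ∷ false ∷ false ∷ false ∷ false ∷ true  ∷ [])
    ∷ (false ∷ false ∷ false ∷ false ∷ false ∷ false ∷ false ∷ false ∷ true  ∷ false ∷ true  ∷ false ∷ true  ∷ true  ∷ true  ∷ false ∷ false ∷ false ∷ true  ∷ true  ∷ false ∷ false ∷ false ∷ true  ∷ [])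
    ∷ (false ∷ false ∷ false ∷ false ∷ false ∷ false ∷ false ∷ false ∷ false ∷ true  ∷ false ∷ true  ∷ false ∷ true  ∷ true  ∷ true  ∷ false ∷ false ∷ false ∷ true  ∷ true  ∷ false ∷ false ∷ true  ∷ [])
    ∷ (false ∷ false ∷ false ∷ false ∷ false ∷ false ∷ false ∷ false ∷ false ∷ false ∷ true  ∷ false ∷ true  ∷ false ∷ true  ∷ true  ∷ true  ∷ false ∷ false ∷ false ∷ true  ∷ true  ∷ false ∷ true  ∷ [])
    ∷ (false ∷ false ∷ false ∷ false ∷ false ∷ false ∷ false ∷ false ∷ false ∷ false ∷ false ∷ true  ∷ false ∷ true  ∷ false ∷ true  ∷ true  ∷ true  ∷ false ∷ false ∷ false ∷ true  ∷ true  ∷ true  ∷ [])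
  ∷ []

combine : {n : ℕ} → Vec Bool n → Vec Word n → Word
combine [] [] = 𝟎
combine (true ∷ as) (r ∷ rs) = r ⊕ combine as rs
combine (false ∷ as) (r ∷ rs) = combine as rs

InGolay : Word → Set
InGolay c = Σ (Vec Bool 12) (λ a → c ≡ combine a generator)

sumWords : List Word → Word
sumWords = List.foldr _⊕_ 𝟎

-- F₂-span of a set S of words: all finite sums of elements of S
-- (over F₂ every linear combination is such a sum; the empty sum is 0).
InSpan : (Word → Set) → Word → Set
InSpan S c = Σ (List Word) (λ L → All S L × c ≡ sumWords L)

O₁₀ : Word → Set
O₁₀ c = InGolay c × weight c ≡ 8 × lookup c zero ≡ true × lookup c (suc zero) ≡ false

O₀₁ : Word → Set
O₀₁ c = InGolay c × weight c ≡ 8 × lookup c zero ≡ false × lookup c (suc zero) ≡ true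

O₁₀∪O₀₁ : Word → Set
O₁₀∪O₀₁ c = O₁₀ c ⊎ O₀₁ c

{-# OPTIONS --safe #-}
module Submission where

-- Both sides are F₂-subspaces of F₂²⁴: the code because `combine _ generator` is
-- linear, the span by construction. So it suffices that every octad in 𝒪₁₀ ∪ 𝒪₀₁
-- is a codeword (it is, by definition) and that every row of the generator
-- matrix is a sum of such octads; twelve explicit octads do the latter.

open import Defs
open import Algebra.Bundles using (CommutativeSemigroup)
open import Data.Bool using (Bool; true; false; _xor_)
open import Data.Bool.Properties using (xor-assoc; xor-comm; xor-identityˡ; xor-same)
open import Data.Bool.ListAction using (any)
open import Data.Fin using (toℕ)
open import Data.List using (List; []; _∷_; _++_)
open import Data.List.Relation.Unary.All as All using (All; []; _∷_)
open import Data.List.Relation.Unary.All.Properties using (++⁺)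
open import Data.Nat using (ℕ; _≡ᵇ_)
open import Data.Product using (_×_; _,_)
open import Data.Sum using (inj₁; inj₂)
open import Data.Vec using (Vec; []; _∷_; zipWith; replicate; tabulate)
open import Data.Vec.Properties using (zipWith-assoc; zipWith-comm; zipWith-identityˡ; zipWith-inverseˡ; map-id)
open import Data.Vec.Relation.Unary.All as VAll using ([]; _∷_)
open import Relation.Binary.PropositionalEquality
open import Algebra.Definitions {A = Word} _≡_ using (Associative; Commutative)
open import Relation.Binary.PropositionalEquality.Algebra using (isMagma)
open import Level using (0ℓ)
open import Relation.Unary using (Pred; _⊆_)

⊕-assoc : Associative _⊕_
⊕-assoc = zipWith-assoc xor-assoc

⊕-comm : Commutative _⊕_
⊕-comm = zipWith-comm xor-comm

⊕-identityˡ : (x : Word) → 𝟎 ⊕ x ≡ x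
⊕-identityˡ = zipWith-identityˡ xor-identityˡ

⊕-self : (x : Word) → x ⊕ x ≡ 𝟎
⊕-self x = trans (cong (_⊕ x) (sym (map-id x))) (zipWith-inverseˡ xor-same x)

⊕-commutativeSemigroup : CommutativeSemigroup _ _
⊕-commutativeSemigroup = record
  { isCommutativeSemigroup = record
    { isSemigroup = record { isMagma = isMagma _⊕_ ; assoc = ⊕-assoc }
    ; comm        = ⊕-comm
    }
  }

open import Algebra.Properties.CommutativeSemigroup ⊕-commutativeSemigroup
  using (interchange; x∙yz≈y∙xz)

combine-xor : {n : ℕ} (a b : Vec Bool n) (rs : Vec Word n) →
              combine (zipWith _xor_ a b) rs ≡ combine a rs ⊕ combine b rs
combine-xor []          []          []       = sym (⊕-identityˡ 𝟎)
combine-xor (true ∷ a)  (true ∷ b)  (r ∷ rs) = begin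
  combine (zipWith _xor_ a b) rs           ≡⟨ combine-xor a b rs ⟩
  combine a rs ⊕ combine b rs              ≡⟨ sym (⊕-identityˡ _) ⟩
  𝟎 ⊕ (combine a rs ⊕ combine b rs)        ≡⟨ cong (_⊕ _) (sym (⊕-self r)) ⟩
  (r ⊕ r) ⊕ (combine a rs ⊕ combine b rs)  ≡⟨ interchange r r _ _ ⟩
  (r ⊕ combine a rs) ⊕ (r ⊕ combine b rs)  ∎
  where open ≡-Reasoning
combine-xor (true ∷ a)  (false ∷ b) (r ∷ rs) =
  trans (cong (r ⊕_) (combine-xor a b rs)) (sym (⊕-assoc r _ _))
combine-xor (false ∷ a) (true ∷ b)  (r ∷ rs) =
  trans (cong (r ⊕_) (combine-xor a b rs)) (x∙yz≈y∙xz r _ _)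
combine-xor (false ∷ a) (false ∷ b) (r ∷ rs) = combine-xor a b rs

sumWords-++ : (L M : List Word) → sumWords (L ++ M) ≡ sumWords L ⊕ sumWords M
sumWords-++ []      M = sym (⊕-identityˡ (sumWords M))
sumWords-++ (x ∷ L) M = trans (cong (x ⊕_) (sumWords-++ L M)) (sym (⊕-assoc x _ _))

record IsSubspace (P : Pred Word 0ℓ) : Set where
  field
    𝟎-closed : P 𝟎
    ⊕-closed : {x y : Word} → P x → P y → P (x ⊕ y)

module _ {P : Pred Word 0ℓ} (subspace : IsSubspace P) where
  open IsSubspace subspace

  sumWords-closed : (L : List Word) → All P L → P (sumWords L)
  sumWords-closed []      []       = 𝟎-closed
  sumWords-closed (x ∷ L) (p ∷ ps) = ⊕-closed p (sumWords-closed L ps)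

  combine-closed : {n : ℕ} (a : Vec Bool n) (rs : Vec Word n) → VAll.All P rs → P (combine a rs)
  combine-closed []          []       []       = 𝟎-closed
  combine-closed (true ∷ a)  (r ∷ rs) (p ∷ ps) = ⊕-closed p (combine-closed a rs ps)
  combine-closed (false ∷ a) (r ∷ rs) (p ∷ ps) = combine-closed a rs ps

  span-least : {S : Pred Word 0ℓ} → S ⊆ P → InSpan S ⊆ P
  span-least S⊆P (L , ps , refl) = sumWords-closed L (All.map S⊆P ps)

span-isSubspace : (S : Pred Word 0ℓ) → IsSubspace (InSpan S)
span-isSubspace S = record
  { 𝟎-closed = [] , [] , refl
  ; ⊕-closed = λ { (L , pL , refl) (M , pM , refl) → L ++ M , ++⁺ pL pM , sym (sumWords-++ L M) }
  }

golay-isSubspace : IsSubspace InGolay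
golay-isSubspace = record
  { 𝟎-closed = replicate 12 false , refl
  ; ⊕-closed = λ { (a , refl) (b , refl) → zipWith _xor_ a b , sym (combine-xor a b generator) }
  }

octad⊆golay : O₁₀∪O₀₁ ⊆ InGolay
octad⊆golay (inj₁ (g , _)) = g
octad⊆golay (inj₂ (g , _)) = g

-- Positions are 0-indexed: the paper's first and second coordinates are 0 and 1.
indicator : {n : ℕ} → List ℕ → Vec Bool n
indicator is = tabulate (λ j → any (toℕ j ≡ᵇ_) is)

o₀ o₁ o₂ o₃ o₄ o₅ o₆ o₇ o₈ o₉ o₁₀ o₁₁ : Word
o₀  = indicator (1 ∷ 3 ∷ 5 ∷ 6 ∷ 7 ∷ 11 ∷ 12 ∷ 23 ∷ [])
o₁  = indicator (1 ∷ 3 ∷ 5 ∷ 6 ∷ 9 ∷ 13 ∷ 17 ∷ 18 ∷ [])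
o₂  = indicator (1 ∷ 3 ∷ 5 ∷ 6 ∷ 8 ∷ 14 ∷ 15 ∷ 22 ∷ [])
o₃  = indicator (1 ∷ 3 ∷ 5 ∷ 7 ∷ 8 ∷ 10 ∷ 16 ∷ 17 ∷ [])
o₄  = indicator (1 ∷ 3 ∷ 5 ∷ 8 ∷ 18 ∷ 19 ∷ 21 ∷ 23 ∷ [])
o₅  = indicator (1 ∷ 3 ∷ 5 ∷ 9 ∷ 11 ∷ 14 ∷ 16 ∷ 19 ∷ [])
o₆  = indicator (1 ∷ 3 ∷ 5 ∷ 13 ∷ 15 ∷ 16 ∷ 20 ∷ 23 ∷ [])
o₇  = indicator (1 ∷ 3 ∷ 6 ∷ 9 ∷ 10 ∷ 12 ∷ 15 ∷ 16 ∷ [])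
o₈  = indicator (1 ∷ 3 ∷ 4 ∷ 5 ∷ 7 ∷ 14 ∷ 18 ∷ 20 ∷ [])
o₉  = indicator (1 ∷ 6 ∷ 8 ∷ 9 ∷ 11 ∷ 12 ∷ 13 ∷ 14 ∷ [])
o₁₀ = indicator (1 ∷ 2 ∷ 3 ∷ 4 ∷ 5 ∷ 8 ∷ 11 ∷ 13 ∷ [])
o₁₁ = indicator (0 ∷ 2 ∷ 4 ∷ 5 ∷ 6 ∷ 10 ∷ 11 ∷ 23 ∷ [])

o₀-octad : O₁₀∪O₀₁ o₀
o₀-octad = inj₂ ((indicator (1 ∷ []) , refl) , refl , refl , refl)
o₁-octad : O₁₀∪O₀₁ o₁
o₁-octad = inj₂ ((indicator (1 ∷ 7 ∷ []) , refl) , refl , refl , refl)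
o₂-octad : O₁₀∪O₀₁ o₂
o₂-octad = inj₂ ((indicator (1 ∷ 7 ∷ 8 ∷ 9 ∷ 10 ∷ 11 ∷ []) , refl) , refl , refl , refl)
o₃-octad : O₁₀∪O₀₁ o₃
o₃-octad = inj₂ ((indicator (1 ∷ 6 ∷ []) , refl) , refl , refl , refl)
o₄-octad : O₁₀∪O₀₁ o₄
o₄-octad = inj₂ ((indicator (1 ∷ 6 ∷ 7 ∷ 9 ∷ 10 ∷ []) , refl) , refl , refl , refl)
o₅-octad : O₁₀∪O₀₁ o₅
o₅-octad = inj₂ ((indicator (1 ∷ 6 ∷ 7 ∷ 8 ∷ []) , refl) , refl , refl , refl)
o₆-octad : O₁₀∪O₀₁ o₆
o₆-octad = inj₂ ((indicator (1 ∷ 6 ∷ 7 ∷ 8 ∷ 9 ∷ []) , refl) , refl , refl , refl)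
o₇-octad : O₁₀∪O₀₁ o₇
o₇-octad = inj₂ ((indicator (1 ∷ 5 ∷ []) , refl) , refl , refl , refl)
o₈-octad : O₁₀∪O₀₁ o₈
o₈-octad = inj₂ ((indicator (1 ∷ 4 ∷ 8 ∷ 9 ∷ []) , refl) , refl , refl , refl)
o₉-octad : O₁₀∪O₀₁ o₉
o₉-octad = inj₂ ((indicator (1 ∷ 3 ∷ []) , refl) , refl , refl , refl)
o₁₀-octad : O₁₀∪O₀₁ o₁₀
o₁₀-octad = inj₂ ((indicator (1 ∷ 2 ∷ []) , refl) , refl , refl , refl)
o₁₁-octad : O₁₀∪O₀₁ o₁₁
o₁₁-octad = inj₁ ((indicator (0 ∷ []) , refl) , refl , refl , refl)

generator⊆span : VAll.All (InSpan O₁₀∪O₀₁) generator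
generator⊆span =
    (o₁₁ ∷ [] , o₁₁-octad ∷ [] , refl)
  ∷ (o₀ ∷ [] , o₀-octad ∷ [] , refl)
  ∷ (o₀ ∷ o₁₀ ∷ [] , o₀-octad ∷ o₁₀-octad ∷ [] , refl)
  ∷ (o₀ ∷ o₉ ∷ [] , o₀-octad ∷ o₉-octad ∷ [] , refl)
  ∷ (o₁ ∷ o₃ ∷ o₆ ∷ o₈ ∷ [] , o₁-octad ∷ o₃-octad ∷ o₆-octad ∷ o₈-octad ∷ [] , refl)
  ∷ (o₀ ∷ o₇ ∷ [] , o₀-octad ∷ o₇-octad ∷ [] , refl)
  ∷ (o₀ ∷ o₃ ∷ [] , o₀-octad ∷ o₃-octad ∷ [] , refl)
  ∷ (o₀ ∷ o₁ ∷ [] , o₀-octad ∷ o₁-octad ∷ [] , refl)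
  ∷ (o₀ ∷ o₁ ∷ o₃ ∷ o₅ ∷ [] , o₀-octad ∷ o₁-octad ∷ o₃-octad ∷ o₅-octad ∷ [] , refl)
  ∷ (o₅ ∷ o₆ ∷ [] , o₅-octad ∷ o₆-octad ∷ [] , refl)
  ∷ (o₀ ∷ o₁ ∷ o₃ ∷ o₄ ∷ o₅ ∷ o₆ ∷ [] , o₀-octad ∷ o₁-octad ∷ o₃-octad ∷ o₄-octad ∷ o₅-octad ∷ o₆-octad ∷ [] , refl)
  ∷ (o₁ ∷ o₂ ∷ o₄ ∷ o₅ ∷ [] , o₁-octad ∷ o₂-octad ∷ o₄-octad ∷ o₅-octad ∷ [] , refl)
  ∷ []

lemma2p8 : (c : Word) → (InSpan O₁₀∪O₀₁ c → InGolay c) × (InGolay c → InSpan O₁₀∪O₀₁ c)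
lemma2p8 c = span-least golay-isSubspace octad⊆golay , golay⊆span
  where
  golay⊆span : InGolay c → InSpan O₁₀∪O₀₁ c
  golay⊆span (a , refl) = combine-closed (span-isSubspace O₁₀∪O₀₁) a generator generator⊆span
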